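{- Let $G$ be a (claw, co-claw)-free graph. If $G$ contains an antenna as an induced subgraph, then $G$ is (isomorphic to) an induced subgraph of the graph $F_1$.
   Context: Graphs are finite and simple. The claw is $K_{1,3}$; the co-claw is its complement (a triangle plus an isolated vertex). $G$ is $H$-free if it contains no member of $H$ as an induced subgraph. The antenna is the graph on vertices $a,b,c,d,e,f$ with edges $ab, bc, cd, da, eb, ec, fe$ (a 4-cycle $abcd$, a vertex $e$ adjacent to $b$ and $c$, and a pendant vertex $f$ attached to $e$). $F_1$ is the graph on vertices $1,\dots,9$ with the 18 edges $12, 14, 23, 34, 25, 35, 56, 19, 49, 59, 69, 67, 27, 78, 17, 38, 48, 68$. -}

module Defs where

open import Data.Nat using (ℕ)
open import Data.Fin using (Fin; zero; suc; toℕ)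
open import Data.Bool using (Bool; true; false; _∨_)
open import Data.Nat using (_≡ᵇ_)
open import Data.List using (List; []; _∷_; any)
open import Data.Product using (Σ; _×_; _,_)
open import Function.Definitions using (Injective)
open import Relation.Binary.PropositionalEquality using (_≡_)
open import Relation.Nullary using (¬_)

record Graph : Set where
  field
    size  : ℕ
    adj   : Fin size → Fin size → Bool
    sym   : ∀ i j → adj i j ≡ adj j i
    irrefl : ∀ i → adj i i ≡ false
open Graph public

_≤ind_ : Graph → Graph → Set
H ≤ind G = Σ (Fin (size H) → Fin (size G)) λ f →
  Injective _≡_ _≡_ f × (∀ i j → adj G (f i) (f j) ≡ adj H i j)

Contains : Graph → Graph → Set
Contains G H = H ≤ind G

Free : Graph → Graph → Set
Free G H = ¬ Contains G H

memEdge : List (ℕ × ℕ) → ℕ → ℕ → Bool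
memEdge [] a b = false
memEdge ((x , y) ∷ es) a b =
  ((x ≡ᵇ a) Data.Bool.∧ (y ≡ᵇ b)) ∨ ((x ≡ᵇ b) Data.Bool.∧ (y ≡ᵇ a)) ∨ memEdge es a b

edgeAdj : (n : ℕ) → List (ℕ × ℕ) → Fin n → Fin n → Bool
edgeAdj n es i j = memEdge es (toℕ i) (toℕ j)

open import Data.Bool.Properties using (∨-comm; ∧-comm; ∨-assoc)
open import Relation.Binary.PropositionalEquality using (refl; cong₂; trans; cong)

memEdge-sym : ∀ es a b → memEdge es a b ≡ memEdge es b a
memEdge-sym [] a b = refl
memEdge-sym ((x , y) ∷ es) a b = trans (sym∨ ((x ≡ᵇ a) Data.Bool.∧ (y ≡ᵇ b)) ((x ≡ᵇ b) Data.Bool.∧ (y ≡ᵇ a)) (memEdge es a b)) (cong (λ r → ((x ≡ᵇ b) Data.Bool.∧ (y ≡ᵇ a)) ∨ ((x ≡ᵇ a) Data.Bool.∧ (y ≡ᵇ b)) ∨ r) (memEdge-sym es a b))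
  where
  sym∨ : ∀ p q r → p ∨ q ∨ r ≡ q ∨ p ∨ r
  sym∨ false q r = refl
  sym∨ true false r = refl
  sym∨ true true r = refl

open import Data.Bool using (not; T)
open import Data.Unit using (tt)

allFin : (n : ℕ) → (Fin n → Bool) → Bool
allFin ℕ.zero p = true
allFin (ℕ.suc n) p = p zero Data.Bool.∧ allFin n (λ i → p (suc i))

allFin-sound : ∀ n p → T (allFin n p) → ∀ i → T (p i)
allFin-sound (ℕ.suc n) p h zero with p zero
... | true = tt
allFin-sound (ℕ.suc n) p h (suc i) with p zero
... | true = allFin-sound n (λ k → p (suc k)) h i

notT : ∀ b → T (not b) → b ≡ false
notT false _ = refl

mkGraph : (n : ℕ) (es : List (ℕ × ℕ)) →
          T (allFin n (λ i → not (edgeAdj n es i i))) → Graph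
mkGraph n es h = record
  { size = n
  ; adj = edgeAdj n es
  ; sym = λ i j → memEdge-sym es (toℕ i) (toℕ j)
  ; irrefl = λ i → notT _ (allFin-sound n _ h i)
  }

claw : Graph
claw = mkGraph 4 ((0 , 1) ∷ (0 , 2) ∷ (0 , 3) ∷ []) tt

coClaw : Graph
coClaw = mkGraph 4 ((0 , 1) ∷ (1 , 2) ∷ (0 , 2) ∷ []) tt

-- Antenna: a=0,b=1,c=2,d=3,e=4,f=5; edges ab,bc,cd,da,eb,ec,fe
antenna : Graph
antenna = mkGraph 6
  ((0 , 1) ∷ (1 , 2) ∷ (2 , 3) ∷ (3 , 0) ∷ (4 , 1) ∷ (4 , 2) ∷ (5 , 4) ∷ []) tt

-- F1: vertex k (1..9) is represented by index k-1; the 18 edges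
-- 12,14,23,34,25,35,56,19,49,59,69,67,27,78,17,38,48,68
F1 : Graph
F1 = mkGraph 9
  ((0 , 1) ∷ (0 , 3) ∷ (1 , 2) ∷ (2 , 3) ∷ (1 , 4) ∷ (2 , 4) ∷
   (4 , 5) ∷ (0 , 8) ∷ (3 , 8) ∷ (4 , 8) ∷ (5 , 8) ∷ (5 , 6) ∷
   (1 , 6) ∷ (6 , 7) ∷ (0 , 6) ∷ (2 , 7) ∷ (3 , 7) ∷ (5 , 7) ∷ []) tt

-- Fix an induced antenna a…f.  Claw- and co-claw-freeness force every other vertex to see
-- exactly {a,b,f}, {c,d,f} or {a,d,e,f} of it (the antenna-neighbourhoods of vertices 7, 8, 9
-- of F₁, whose vertices 1…6 are a…f), and force two further vertices to be of different kinds
-- and adjacent exactly when the corresponding vertices of F₁ are.  Sending the antenna to 1…6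
-- and every other vertex to its kind is therefore an induced embedding into F₁.  Both facts
-- concern at most eight vertices and are verified by exhaustive search for a claw or co-claw.
module Submission where

open import Defs hiding (sym)
open import Data.Nat using (ℕ; suc)
open import Data.Bool using (Bool; true; false)
import Data.Bool.Properties as Bool
open import Data.Empty using (⊥-elim)
open import Data.Fin using (Fin; zero; suc; _↑ˡ_; _↑ʳ_; splitAt)
open import Data.Fin.Properties
  using (_≟_; any?; all?; ↑ˡ-injective; ↑ʳ-injective; splitAt-↑ˡ; splitAt-↑ʳ)
open import Data.Fin.Subset using (Subset)
open import Data.Fin.Subset.Properties using (anySubset?)
open import Data.Product using (∃; _×_; _,_; proj₁; proj₂)
open import Data.Sum using (_⊎_; inj₁; inj₂)
open import Data.Vec using ([]; _∷_; lookup; tabulate)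
open import Data.Vec.Properties using (lookup∘tabulate; ≡-dec)
open import Function.Definitions using (Injective)
open import Relation.Binary.PropositionalEquality
  using (_≡_; _≢_; refl; sym; trans; cong; subst₂)
open import Relation.Nullary using (Dec; yes; no; ¬_)
open import Relation.Nullary.Decidable
  using (_×-dec_; _⊎-dec_; _→-dec_; ¬?; from-yes; decidable-stable)
open import Relation.Unary using (Pred; Decidable)

Adjacency : ℕ → Set
Adjacency k = Fin k → Fin k → Bool

-- H ≤ind G unfolds to adj H ⊑ adj G.
_⊑_ : ∀ {n k} → Adjacency n → Adjacency k → Set
_⊑_ {n} {k} S H = ∃ λ (f : Fin n → Fin k) →
  Injective _≡_ _≡_ f × (∀ i j → H (f i) (f j) ≡ S i j)

⊑-trans : ∀ {n k m} {S : Adjacency n} {H : Adjacency k} {K : Adjacency m} →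
          S ⊑ H → H ⊑ K → S ⊑ K
⊑-trans (f , f-inj , f-adj) (g , g-inj , g-adj) =
  (λ i → g (f i)) , (λ eq → f-inj (g-inj eq)) , λ i j → trans (g-adj (f i) (f j)) (f-adj i j)

extend : ∀ {n} → Adjacency n → Subset n → Adjacency (suc n)
extend H r zero    zero    = false
extend H r zero    (suc j) = lookup r j
extend H r (suc i) zero    = lookup r i
extend H r (suc i) (suc j) = H i j

module _ (G : Graph) {n : ℕ} {S : Adjacency n} (S⊑G : S ⊑ adj G) where

  private
    f : Fin n → Fin (size G)
    f = proj₁ S⊑G

  neighbourhood : Fin (size G) → Subset n
  neighbourhood v = tabulate λ i → adj G v (f i)

  ⊑-extend : ∀ v → (∀ i → f i ≢ v) → extend S (neighbourhood v) ⊑ adj G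
  ⊑-extend v v∉f = g , g-inj , g-adj
    where
    g : Fin (suc n) → Fin (size G)
    g zero    = v
    g (suc i) = f i

    g-inj : Injective _≡_ _≡_ g
    g-inj {zero}  {zero}  _  = refl
    g-inj {zero}  {suc j} eq = ⊥-elim (v∉f j (sym eq))
    g-inj {suc i} {zero}  eq = ⊥-elim (v∉f i eq)
    g-inj {suc i} {suc j} eq = cong suc (proj₁ (proj₂ S⊑G) eq)

    g-adj : ∀ i j → adj G (g i) (g j) ≡ extend S (neighbourhood v) i j
    g-adj zero    zero    = irrefl G v
    g-adj zero    (suc j) = sym (lookup∘tabulate (λ k → adj G v (f k)) j)
    g-adj (suc i) zero    =
      trans (Graph.sym G (f i) v) (sym (lookup∘tabulate (λ k → adj G v (f k)) i))
    g-adj (suc i) (suc j) = proj₂ (proj₂ S⊑G) i j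

IsEmbedding : ∀ {n k} → Adjacency n → Adjacency k → (Fin n → Fin k) → Set
IsEmbedding S H f = (∀ i j → H (f i) (f j) ≡ S i j) × (∀ i j → f i ≡ f j → i ≡ j)

isEmbedding? : ∀ {n k} (S : Adjacency n) (H : Adjacency k) → Decidable (IsEmbedding S H)
isEmbedding? S H f =
  (all? λ i → all? λ j → H (f i) (f j) Bool.≟ S i j) ×-dec
  (all? λ i → all? λ j → (f i ≟ f j) →-dec (i ≟ j))

IsEmbedding⇒⊑ : ∀ {n k} {S : Adjacency n} {H : Adjacency k} f → IsEmbedding S H f → S ⊑ H
IsEmbedding⇒⊑ f (f-adj , f-inj) = f , (λ {i} {j} → f-inj i j) , f-adj

fourVertices : ∀ {k} → Fin k → Fin k → Fin k → Fin k → Fin 4 → Fin k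
fourVertices a b c d = lookup (a ∷ b ∷ c ∷ d ∷ [])

ClawOrCoClaw : ∀ {k} → Adjacency k → Set
ClawOrCoClaw H = ∃ λ a → ∃ λ b → ∃ λ c → ∃ λ d →
  IsEmbedding (adj claw) H (fourVertices a b c d) ⊎
  IsEmbedding (adj coClaw) H (fourVertices a b c d)

ClawOrCoClaw⇒⊑ : ∀ {k} {H : Adjacency k} → ClawOrCoClaw H → adj claw ⊑ H ⊎ adj coClaw ⊑ H
ClawOrCoClaw⇒⊑ {H = H} (a , b , c , d , inj₁ claw-in-H) =
  inj₁ (IsEmbedding⇒⊑ {S = adj claw} {H = H} (fourVertices a b c d) claw-in-H)
ClawOrCoClaw⇒⊑ {H = H} (a , b , c , d , inj₂ coClaw-in-H) =
  inj₂ (IsEmbedding⇒⊑ {S = adj coClaw} {H = H} (fourVertices a b c d) coClaw-in-H)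

clawOrCoClaw? : ∀ {k} (H : Adjacency k) → Dec (ClawOrCoClaw H)
clawOrCoClaw? H = any? λ a → any? λ b → any? λ c → any? λ d →
  isEmbedding? (adj claw) H (fourVertices a b c d) ⊎-dec
  isEmbedding? (adj coClaw) H (fourVertices a b c d)

allSubset? : ∀ {n p} {P : Pred (Subset n) p} → Decidable P → Dec (∀ s → P s)
allSubset? P? with anySubset? (λ s → ¬? (P? s))
... | yes (s , ¬Ps) = no λ ∀P → ¬Ps (∀P s)
... | no  ∄¬P      = yes λ s → decidable-stable (P? s) λ ¬Ps → ∄¬P (s , ¬Ps)

↑ˡ≢↑ʳ : ∀ {m n} (i : Fin m) (j : Fin n) → i ↑ˡ n ≢ m ↑ʳ j
↑ˡ≢↑ʳ {m} {n} i j eq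
  with trans (sym (splitAt-↑ˡ m i n)) (trans (cong (splitAt m) eq) (splitAt-↑ʳ m n j))
... | ()

-- type e is the antenna-neighbourhood of vertex 7 + e of F₁.
type : Fin 3 → Subset 6
type zero             = true  ∷ true  ∷ false ∷ false ∷ false ∷ true ∷ []
type (suc zero)       = false ∷ false ∷ true  ∷ true  ∷ false ∷ true ∷ []
type (suc (suc zero)) = true  ∷ false ∷ false ∷ true  ∷ true  ∷ true ∷ []

-- The exhaustive checks are opaque so that they are not re-evaluated where they are used.
opaque
  F1-antenna : ∀ i j → adj F1 (i ↑ˡ 3) (j ↑ˡ 3) ≡ adj antenna i j
  F1-antenna = from-yes (all? λ i → all? λ j →
    adj F1 (i ↑ˡ 3) (j ↑ˡ 3) Bool.≟ adj antenna i j)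

opaque
  F1-type : ∀ i e → adj F1 (i ↑ˡ 3) (6 ↑ʳ e) ≡ lookup (type e) i
  F1-type = from-yes (all? λ i → all? λ e →
    adj F1 (i ↑ˡ 3) (6 ↑ʳ e) Bool.≟ lookup (type e) i)

opaque
  oneVertexExtension : ∀ r → (∃ λ e → r ≡ type e) ⊎ ClawOrCoClaw (extend (adj antenna) r)
  oneVertexExtension = from-yes (allSubset? λ r →
    any? (λ e → ≡-dec Bool._≟_ r (type e)) ⊎-dec clawOrCoClaw? (extend (adj antenna) r))

TwoVertexExtension : Fin 3 → Fin 3 → Bool → Set
TwoVertexExtension e₁ e₂ c = (e₁ ≢ e₂ × c ≡ adj F1 (6 ↑ʳ e₁) (6 ↑ʳ e₂))
  ⊎ ClawOrCoClaw (extend (extend (adj antenna) (type e₁)) (c ∷ type e₂))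

twoVertexExtension? : ∀ e₁ e₂ c → Dec (TwoVertexExtension e₁ e₂ c)
twoVertexExtension? e₁ e₂ c =
  (¬? (e₁ ≟ e₂) ×-dec c Bool.≟ adj F1 (6 ↑ʳ e₁) (6 ↑ʳ e₂))
  ⊎-dec clawOrCoClaw? (extend (extend (adj antenna) (type e₁)) (c ∷ type e₂))

opaque
  twoVertexExtension-both :
    ∀ e₁ e₂ → TwoVertexExtension e₁ e₂ false × TwoVertexExtension e₁ e₂ true
  twoVertexExtension-both = from-yes (all? λ e₁ → all? λ e₂ →
    twoVertexExtension? e₁ e₂ false ×-dec twoVertexExtension? e₁ e₂ true)

twoVertexExtension : ∀ e₁ e₂ c → TwoVertexExtension e₁ e₂ c
twoVertexExtension e₁ e₂ false = proj₁ (twoVertexExtension-both e₁ e₂)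
twoVertexExtension e₁ e₂ true  = proj₂ (twoVertexExtension-both e₁ e₂)

module AntennaCopy (G : Graph) (clawFree : Free G claw) (coClawFree : Free G coClaw)
                   (antenna⊑G : adj antenna ⊑ adj G) where

  φ : Fin 6 → Fin (size G)
  φ = proj₁ antenna⊑G

  no-clawOrCoClaw : ∀ {k} {H : Adjacency k} → H ⊑ adj G → ¬ ClawOrCoClaw H
  no-clawOrCoClaw {H = H} H⊑G found with ClawOrCoClaw⇒⊑ {H = H} found
  ... | inj₁ claw⊑H   = clawFree (⊑-trans {H = H} {K = adj G} claw⊑H H⊑G)
  ... | inj₂ coClaw⊑H = coClawFree (⊑-trans {H = H} {K = adj G} coClaw⊑H H⊑G)

  Outside : Fin (size G) → Set
  Outside v = ∀ i → φ i ≢ v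

  N : Fin (size G) → Subset 6
  N = neighbourhood G antenna⊑G

  outside-type : ∀ {v} → Outside v → ∃ λ e → N v ≡ type e
  outside-type {v} v-out with oneVertexExtension (N v)
  ... | inj₁ typed = typed
  ... | inj₂ found = ⊥-elim (no-clawOrCoClaw (⊑-extend G antenna⊑G v v-out) found)

  outside-pair : ∀ {u v e₁ e₂} → u ≢ v → Outside u → Outside v →
                 N v ≡ type e₁ → N u ≡ type e₂ →
                 e₁ ≢ e₂ × adj G u v ≡ adj F1 (6 ↑ʳ e₁) (6 ↑ʳ e₂)
  outside-pair {u} {v} {e₁} {e₂} u≢v u-out v-out Nv Nu
    with twoVertexExtension e₁ e₂ (adj G u v)
  ... | inj₁ typed = typed
  ... | inj₂ found = ⊥-elim (no-clawOrCoClaw pattern⊑G found)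
    where
    v⊑G : extend (adj antenna) (N v) ⊑ adj G
    v⊑G = ⊑-extend G antenna⊑G v v-out
    u∉ : ∀ i → proj₁ v⊑G i ≢ u
    u∉ zero    = λ v≡u → u≢v (sym v≡u)
    u∉ (suc i) = u-out i
    pattern⊑G : extend (extend (adj antenna) (type e₁)) (adj G u v ∷ type e₂) ⊑ adj G
    pattern⊑G = subst₂ (λ r s → extend (extend (adj antenna) r) (adj G u v ∷ s) ⊑ adj G) Nv Nu
                       (⊑-extend G v⊑G u u∉)

  data Position (v : Fin (size G)) : Set where
    onAntenna  : ∀ i → φ i ≡ v → Position v
    offAntenna : ∀ e → Outside v → N v ≡ type e → Position v

  position : ∀ v → Position v
  position v with any? (λ i → φ i ≟ v)
  ... | yes (i , φi≡v) = onAntenna i φi≡v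
  ... | no  v∉φ        = offAntenna (proj₁ typed) v-out (proj₂ typed)
    where
    v-out : Outside v
    v-out i φi≡v = v∉φ (i , φi≡v)
    typed : ∃ λ e → N v ≡ type e
    typed = outside-type v-out

  index : ∀ {v} → Position v → Fin 9
  index (onAntenna i _)    = i ↑ˡ 3
  index (offAntenna e _ _) = 6 ↑ʳ e

  Faithful : ∀ {u v} → Position u → Position v → Set
  Faithful {u} {v} p q = index p ≢ index q × adj F1 (index p) (index q) ≡ adj G u v

  faithful-flip : ∀ {u v} (p : Position u) (q : Position v) → Faithful p q → Faithful q p
  faithful-flip {u} {v} p q (p≢q , pq) =
    (λ eq → p≢q (sym eq)) , trans (Graph.sym F1 (index q) (index p)) (trans pq (Graph.sym G u v))

  faithful-onOff : ∀ {v} i e (v-out : Outside v) (Nv : N v ≡ type e) →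
                   Faithful (onAntenna i refl) (offAntenna e v-out Nv)
  faithful-onOff {v} i e _ Nv =
    ↑ˡ≢↑ʳ i e ,
    trans (F1-type i e) (trans (cong (λ r → lookup r i) (sym Nv))
                        (trans (lookup∘tabulate (λ k → adj G v (φ k)) i) (Graph.sym G v (φ i))))

  faithful : ∀ {u v} → u ≢ v → (p : Position u) (q : Position v) → Faithful p q
  faithful u≢v (onAntenna i refl) (onAntenna j refl) =
    (λ eq → u≢v (cong φ (↑ˡ-injective 3 i j eq))) ,
    trans (F1-antenna i j) (sym (proj₂ (proj₂ antenna⊑G) i j))
  faithful _ (onAntenna i refl) (offAntenna e v-out Nv) = faithful-onOff i e v-out Nv
  faithful _ p@(offAntenna e u-out Nu) q@(onAntenna i refl) =
    faithful-flip q p (faithful-onOff i e u-out Nu)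
  faithful u≢v (offAntenna e₂ u-out Nu) (offAntenna e₁ v-out Nv)
    with outside-pair u≢v u-out v-out Nv Nu
  ... | e₁≢e₂ , uv =
    (λ eq → e₁≢e₂ (sym (↑ʳ-injective 6 e₂ e₁ eq))) ,
    trans (Graph.sym F1 (6 ↑ʳ e₂) (6 ↑ʳ e₁)) (sym uv)

  toF1 : Fin (size G) → Fin 9
  toF1 v = index (position v)

  toF1-injective : Injective _≡_ _≡_ toF1
  toF1-injective {u} {v} eq with u ≟ v
  ... | yes u≡v = u≡v
  ... | no  u≢v = ⊥-elim (proj₁ (faithful u≢v (position u) (position v)) eq)

  toF1-adj : ∀ u v → adj F1 (toF1 u) (toF1 v) ≡ adj G u v
  toF1-adj u v with u ≟ v
  ... | yes refl = trans (irrefl F1 (toF1 u)) (sym (irrefl G u))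
  ... | no  u≢v  = proj₂ (faithful u≢v (position u) (position v))

mainTheorem5 : (G : Graph) → Free G claw → Free G coClaw →
    Contains G antenna → G ≤ind F1
mainTheorem5 G clawFree coClawFree antenna⊑G = toF1 , toF1-injective , toF1-adj
  where open AntennaCopy G clawFree coClawFree antenna⊑G
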